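{- Let $q \ge 7$ be an odd prime power. In $PG(2,q)$ with homogeneous coordinates $(x,y,z)$, for $k \in GF(q)$, $k \neq 0$, let $C_k$ denote the non-degenerate conic $\{(x,y,z) : xy + kz^2 = 0\}$. Then there exist $a, b \in GF(q)\setminus\{0\}$, $a \ne b$, such that $C_a$ and $C_b$ are mutually exterior.
   Context: $PG(2,q)$ is the Desarguesian projective plane over $GF(q)$. For $q$ odd, a point not on a non-degenerate conic $C$ is exterior to $C$ if it lies on two tangent lines of $C$, and interior if it lies on no tangent line of $C$. Two conics $C_a$ and $C_b$ are mutually exterior if every point lying on exactly one of the two conics is exterior to the other conic. -}

module Defs where

open import Level using (0ℓ)
open import Data.Nat using (ℕ; suc; _^_)
open import Data.Nat.Primality using (Prime)
open import Data.Fin using (Fin)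
open import Data.Product using (Σ; ∃; ∃-syntax; _×_; _,_)
open import Data.Sum using (_⊎_)
open import Relation.Nullary using (¬_)
open import Relation.Binary.PropositionalEquality using (_≡_)
open import Algebra.Structures using (IsCommutativeRing)
open import Function.Bundles using (_⤖_)

IsPrimePower : ℕ → Set
IsPrimePower q = ∃[ p ] ∃[ n ] (Prime p × q ≡ p ^ suc n)

record Field : Set₁ where
  field
    Carrier : Set
    _+_ _*_ : Carrier → Carrier → Carrier
    -_      : Carrier → Carrier
    0# 1#   : Carrier
    isCommutativeRing : IsCommutativeRing _≡_ _+_ _*_ -_ 0# 1#
    0≢1     : ¬ (0# ≡ 1#)
    inverse : ∀ x → ¬ (x ≡ 0#) → ∃[ y ] (x * y ≡ 1#)
  infixl 7 _*_
  infixl 6 _+_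

record FiniteField (q : ℕ) : Set₁ where
  field
    field′ : Field
  open Field field′ public
  field
    enumeration : Carrier ⤖ Fin q

module Geometry {q : ℕ} (F : FiniteField q) where
  open FiniteField F

  Triple : Set
  Triple = Carrier × Carrier × Carrier

  NonZero : Triple → Set
  NonZero (x , y , z) = ¬ (x ≡ 0# × y ≡ 0# × z ≡ 0#)

  -- two triples represent the same projective point/line
  Proportional : Triple → Triple → Set
  Proportional (x , y , z) (x′ , y′ , z′) =
    ∃[ c ] (¬ (c ≡ 0#) × x′ ≡ c * x × y′ ≡ c * y × z′ ≡ c * z)

  _∈L_ : Triple → Triple → Set
  (x , y , z) ∈L (u , v , w) = u * x + v * y + w * z ≡ 0#

  OnC : Carrier → Triple → Set
  OnC k (x , y , z) = x * y + k * (z * z) ≡ 0#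

  Tangent : Carrier → Triple → Set
  Tangent k L =
    NonZero L ×
    ∃[ P ] (NonZero P × P ∈L L × OnC k P ×
            (∀ Q → NonZero Q → Q ∈L L → OnC k Q → Proportional P Q))

  Exterior : Carrier → Triple → Set
  Exterior k P =
    NonZero P × ¬ OnC k P ×
    ∃[ L₁ ] ∃[ L₂ ] (Tangent k L₁ × Tangent k L₂ × P ∈L L₁ × P ∈L L₂ ×
                     ¬ Proportional L₁ L₂ ×
                     (∀ L → Tangent k L → P ∈L L →
                        Proportional L₁ L ⊎ Proportional L₂ L))

  MutuallyExterior : Carrier → Carrier → Set
  MutuallyExterior a b =
    (∀ P → NonZero P → OnC a P → ¬ OnC b P → Exterior b P) ×
    (∀ P → NonZero P → OnC b P → ¬ OnC a P → Exterior a P)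

-- Every point of C_k other than (1 : 0 : 0) is (s² : −k : s) for a unique s, with tangent line
-- [−k : s² : 2ks].  A point (x : y : z) with y ≠ 0 lies on that tangent iff (ys + kz)² = k(xy + kz²),
-- and every tangent through it arises this way; so, as 2 ≠ 0, the point is exterior to C_k as soon
-- as k(xy + kz²) is a nonzero square.  For a point of C_a off C_b this quantity is b(b − a)z², hence
-- C_a and C_b are mutually exterior whenever a(a − b) and b(b − a) are nonzero squares.  The
-- Pythagorean triple (2m, m² − 1, m² + 1) provides a = (2m)², b = −(m² − 1)² for any
-- m ∉ {0, ±1, ±√−1}; such an m exists because q ≥ 7, and 2 ≠ 0 because otherwise x ↦ x + 1 would be
-- a fixed-point-free involution of a set of odd size q.

{-# OPTIONS --safe #-}
module Submission where

open import Defs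
open import Level using (0ℓ)
open import Algebra.Bundles using (CommutativeRing)
open import Algebra.Solver.Ring.AlmostCommutativeRing
  using (fromCommutativeRing; _-Raw-AlmostCommutative⟶_)
import Algebra.Solver.Ring as RingSolver
open import Data.Empty using (⊥-elim)
open import Data.Fin as Fin using (Fin; zero; suc; punchIn; punchOut)
open import Data.Fin.Properties as Fin
  using (suc-injective; punchIn-injective; punchInᵢ≢i; punchIn-punchOut; injective⇒≤)
open import Data.Integer as ℤ using (ℤ; -[1+_]; _⊖_; _◃_; sign; ∣_∣)
import Data.Integer.Properties as ℤ
open import Data.List using (List; []; _∷_; length; lookup)
open import Data.List.Membership.Propositional using (_∈_)
open import Data.List.Relation.Unary.Any using (here; there; index)
open import Data.List.Relation.Unary.Any.Properties using (lookup-index)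
open import Data.Maybe using (Maybe; just; nothing)
open import Data.Nat as ℕ using (ℕ; zero; suc; _%_; _≤_; _≥_)
import Data.Nat.Properties as ℕ
open import Data.Product using (∃-syntax; _×_; _,_; proj₁; proj₂)
open import Data.Sign as Sign using (Sign)
open import Data.Sum as Sum using (_⊎_; inj₁; inj₂; [_,_]′)
open import Function using (id; _∘_)
open import Function.Bundles using (Inverse)
open import Function.Properties.Bijection using (⤖⇒↔)
open import Relation.Binary.Bundles using (Setoid)
open import Relation.Binary.Definitions using (DecidableEquality)
open import Relation.Binary.PropositionalEquality
open import Relation.Nullary using (¬_; Dec; yes; no; ¬?; _×-dec_; contradiction)
open import Relation.Nullary.Decidable using (map′)

-- The library's ring solver needs a coefficient ring mapped into R; for identities
-- involving negation in an arbitrary commutative ring that is ℤ, via n ↦ n · 1#.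
module IntegerCoefficients {c ℓ} (R : CommutativeRing c ℓ) where

  open CommutativeRing R hiding (refl; sym; trans; reflexive; setoid)
  open Setoid (CommutativeRing.setoid R) using ()
    renaming (refl to ≈-refl; sym to ≈-sym; trans to ≈-trans; reflexive to ≈-reflexive)
  open import Algebra.Properties.Ring ring using (-‿involutive; -0#≈0#; -1*x≈-x)
  open import Algebra.Properties.AbelianGroup +-abelianGroup using (⁻¹-∙-comm)
  open import Algebra.Properties.CommutativeSemigroup *-commutativeSemigroup using (interchange)
  -- This version of n · x unfolds 2 · 1# to 1# + 1#, so the constant # 2 below is 2# on the nose.
  open import Algebra.Properties.Semiring.Mult.TCOptimised semiring using (1+×; ×-homo-+; ×1-homo-*)
    renaming (_×_ to _·_)
  open import Relation.Binary.Reasoning.Setoid (CommutativeRing.setoid R)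

  private
    ⟦_⟧ : ℤ → Carrier
    ⟦ ℤ.+ n ⟧ = n · 1#
    ⟦ -[1+ n ] ⟧ = - (suc n · 1#)

    ⟦⊖⟧ : ∀ m n → ⟦ m ⊖ n ⟧ ≈ m · 1# - n · 1#
    ⟦⊖⟧ m zero = ≈-trans (≈-sym (+-identityʳ _)) (+-congˡ (≈-sym -0#≈0#))
    ⟦⊖⟧ zero (suc n) = ≈-sym (+-identityˡ _)
    ⟦⊖⟧ (suc m) (suc n) = begin
      ⟦ suc m ⊖ suc n ⟧             ≡⟨ cong ⟦_⟧ (ℤ.[1+m]⊖[1+n]≡m⊖n m n) ⟩
      ⟦ m ⊖ n ⟧                     ≈⟨ ⟦⊖⟧ m n ⟩
      a - b                         ≈⟨ +-congʳ (≈-sym (+-identityˡ a)) ⟩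
      (0# + a) - b                  ≈⟨ +-congʳ (+-congʳ (≈-sym (-‿inverseʳ 1#))) ⟩
      ((1# - 1#) + a) - b           ≈⟨ +-congʳ (≈-trans (+-assoc 1# (- 1#) a) (+-congˡ (+-comm (- 1#) a))) ⟩
      (1# + (a - 1#)) - b           ≈⟨ +-congʳ (≈-sym (+-assoc 1# a (- 1#))) ⟩
      ((1# + a) - 1#) - b           ≈⟨ +-assoc (1# + a) (- 1#) (- b) ⟩
      (1# + a) + (- 1# - b)         ≈⟨ +-congˡ (⁻¹-∙-comm 1# b) ⟩
      (1# + a) - (1# + b)           ≈⟨ ≈-sym (+-cong (1+× m 1#) (-‿cong (1+× n 1#))) ⟩
      suc m · 1# - suc n · 1#       ∎
      where
      a b : Carrier
      a = m · 1#
      b = n · 1#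

    +-homo : ∀ i j → ⟦ i ℤ.+ j ⟧ ≈ ⟦ i ⟧ + ⟦ j ⟧
    +-homo (ℤ.+ m) (ℤ.+ n) = ×-homo-+ 1# m n
    +-homo (ℤ.+ m) -[1+ n ] = ⟦⊖⟧ m (suc n)
    +-homo -[1+ m ] (ℤ.+ n) = ≈-trans (⟦⊖⟧ n (suc m)) (+-comm _ _)
    +-homo -[1+ m ] -[1+ n ] = begin
      - (suc (suc (m ℕ.+ n)) · 1#)          ≡⟨ cong (λ k → - (suc k · 1#)) (sym (ℕ.+-suc m n)) ⟩
      - ((suc m ℕ.+ suc n) · 1#)            ≈⟨ -‿cong (×-homo-+ 1# (suc m) (suc n)) ⟩
      - (suc m · 1# + suc n · 1#)           ≈⟨ ≈-sym (⁻¹-∙-comm _ _) ⟩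
      - (suc m · 1#) - (suc n · 1#)         ∎

    -‿homo : ∀ i → ⟦ ℤ.- i ⟧ ≈ - ⟦ i ⟧
    -‿homo -[1+ n ] = ≈-sym (-‿involutive _)
    -‿homo (ℤ.+ zero) = ≈-sym -0#≈0#
    -‿homo (ℤ.+ suc n) = ≈-refl

    ⟦_⟧ₛ : Sign → Carrier
    ⟦ Sign.+ ⟧ₛ = 1#
    ⟦ Sign.- ⟧ₛ = - 1#

    ⟦◃⟧ : ∀ s n → ⟦ s ◃ n ⟧ ≈ ⟦ s ⟧ₛ * (n · 1#)
    ⟦◃⟧ s zero = ≈-sym (zeroʳ _)
    ⟦◃⟧ Sign.+ (suc n) = ≈-sym (*-identityˡ _)
    ⟦◃⟧ Sign.- (suc n) = ≈-sym (-1*x≈-x _)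

    ⟦*⟧ₛ : ∀ s t → ⟦ s Sign.* t ⟧ₛ ≈ ⟦ s ⟧ₛ * ⟦ t ⟧ₛ
    ⟦*⟧ₛ Sign.+ t = ≈-sym (*-identityˡ _)
    ⟦*⟧ₛ Sign.- Sign.+ = ≈-sym (-1*x≈-x _)
    ⟦*⟧ₛ Sign.- Sign.- = ≈-sym (≈-trans (-1*x≈-x _) (-‿involutive _))

    ⟦sign◃∣∣⟧ : ∀ i → ⟦ i ⟧ ≈ ⟦ sign i ⟧ₛ * (∣ i ∣ · 1#)
    ⟦sign◃∣∣⟧ i = ≈-trans (≈-reflexive (cong ⟦_⟧ (sym (ℤ.◃-inverse i)))) (⟦◃⟧ (sign i) ∣ i ∣)

    *-homo : ∀ i j → ⟦ i ℤ.* j ⟧ ≈ ⟦ i ⟧ * ⟦ j ⟧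
    *-homo i j = begin
      ⟦ (sign i Sign.* sign j) ◃ (∣ i ∣ ℕ.* ∣ j ∣) ⟧                  ≈⟨ ⟦◃⟧ (sign i Sign.* sign j) (∣ i ∣ ℕ.* ∣ j ∣) ⟩
      ⟦ sign i Sign.* sign j ⟧ₛ * ((∣ i ∣ ℕ.* ∣ j ∣) · 1#)            ≈⟨ *-cong (⟦*⟧ₛ (sign i) (sign j)) (×1-homo-* ∣ i ∣ ∣ j ∣) ⟩
      (⟦ sign i ⟧ₛ * ⟦ sign j ⟧ₛ) * ((∣ i ∣ · 1#) * (∣ j ∣ · 1#))     ≈⟨ interchange _ _ _ _ ⟩
      (⟦ sign i ⟧ₛ * (∣ i ∣ · 1#)) * (⟦ sign j ⟧ₛ * (∣ j ∣ · 1#))     ≈⟨ ≈-sym (*-cong (⟦sign◃∣∣⟧ i) (⟦sign◃∣∣⟧ j)) ⟩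
      ⟦ i ⟧ * ⟦ j ⟧                                                   ∎

    homomorphism : ℤ.+-*-rawRing -Raw-AlmostCommutative⟶ fromCommutativeRing R
    homomorphism = record
      { ⟦_⟧ = ⟦_⟧ ; +-homo = +-homo ; *-homo = *-homo ; -‿homo = -‿homo
      ; 0-homo = ≈-refl ; 1-homo = ≈-refl }

    _≟ℤ_ : ∀ i j → Maybe (⟦ i ⟧ ≈ ⟦ j ⟧)
    i ≟ℤ j with i ℤ.≟ j
    ... | yes refl = just ≈-refl
    ... | no _ = nothing

  private module Solver = RingSolver ℤ.+-*-rawRing (fromCommutativeRing R) homomorphism _≟ℤ_
  open Solver public using (Polynomial; solve; _:=_; _:+_; _:-_; _:*_; :-_)

  infix 10 #_
  #_ : ∀ {n} → ℕ → Polynomial n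
  # k = Solver.con (ℤ.+ k)

fixedPointFreeInvolution⇒even : ∀ n (f : Fin n → Fin n) →
  (∀ i → f (f i) ≡ i) → (∀ i → f i ≢ i) → n % 2 ≡ 0
fixedPointFreeInvolution⇒even 0 f involutive fixedPointFree = refl
fixedPointFreeInvolution⇒even 1 f involutive fixedPointFree with f zero in f0
... | zero = ⊥-elim (fixedPointFree zero f0)
fixedPointFreeInvolution⇒even (suc (suc n)) f involutive fixedPointFree with f zero in f0
... | zero = ⊥-elim (fixedPointFree zero f0)
... | suc j = fixedPointFreeInvolution⇒even n g g-involutive g-fixedPointFree
  where
  -- f restricts to a fixed-point-free involution g of the complement of {0, f 0}, enumerated by ι.
  ι : Fin n → Fin (suc (suc n))
  ι i = suc (punchIn j i)

  ι-injective : ∀ {i k} → ι i ≡ ι k → i ≡ k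
  ι-injective = punchIn-injective j _ _ ∘ suc-injective

  covered : ∀ i → ∃[ k ] ι k ≡ f (ι i)
  covered i with f (ι i) in fι
  ... | zero = ⊥-elim (punchInᵢ≢i j i (suc-injective ι≡f0))
    where
    ι≡f0 : ι i ≡ suc j
    ι≡f0 = trans (sym (involutive (ι i))) (trans (cong f fι) f0)
  ... | suc k = punchOut j≢k , cong suc (punchIn-punchOut j≢k)
    where
    j≢k : j ≢ k
    j≢k refl with () ← trans (sym (involutive (ι i))) (trans (cong f (trans fι (sym f0))) (involutive zero))

  g : Fin n → Fin n
  g i = proj₁ (covered i)

  ι∘g : ∀ i → ι (g i) ≡ f (ι i)
  ι∘g i = proj₂ (covered i)

  g-involutive : ∀ i → g (g i) ≡ i
  g-involutive i = ι-injective (trans (ι∘g (g i)) (trans (cong f (ι∘g i)) (involutive (ι i))))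

  g-fixedPointFree : ∀ i → g i ≢ i
  g-fixedPointFree i gi≡i = fixedPointFree (ι i) (trans (sym (ι∘g i)) (cong ι gi≡i))

injection-into-list⇒≤ : ∀ {A : Set} {m} (xs : List A) (e : Fin m → A) →
  (∀ {i j} → e i ≡ e j → i ≡ j) → (∀ i → e i ∈ xs) → m ≤ length xs
injection-into-list⇒≤ xs e e-injective e∈xs = injective⇒≤ index-injective
  where
  index-injective : ∀ {i j} → index (e∈xs i) ≡ index (e∈xs j) → i ≡ j
  index-injective {i} {j} same = e-injective (begin
    e i                         ≡⟨ lookup-index (e∈xs i) ⟩
    lookup xs (index (e∈xs i))  ≡⟨ cong (lookup xs) same ⟩
    lookup xs (index (e∈xs j))  ≡⟨ lookup-index (e∈xs j) ⟨
    e j                         ∎)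
    where open ≡-Reasoning

module DecidableField (F : Field) (_≟_ : DecidableEquality (Field.Carrier F)) where

  open Field F

  commutativeRing : CommutativeRing 0ℓ 0ℓ
  commutativeRing = record { isCommutativeRing = isCommutativeRing }

  open CommutativeRing commutativeRing public
    using (_-_; *-comm; *-assoc; zeroˡ; zeroʳ; *-identityˡ; *-identityʳ; +-identityʳ; -‿inverseʳ)
  open IntegerCoefficients commutativeRing public

  2# : Carrier
  2# = 1# + 1#

  -- The ring solver certifies an identity  a = b + p₁ e₁ + … + pₙ eₙ ; these turn it
  -- into  a ≡ b  once every eᵢ is known to vanish.
  ≡-mod₁ : ∀ {a b p₁ e₁} → a ≡ b + p₁ * e₁ → e₁ ≡ 0# → a ≡ b
  ≡-mod₁ {b = b} {p₁} a≡ refl = trans a≡ (trans (cong (b +_) (zeroʳ p₁)) (+-identityʳ b))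

  ≡-mod₂ : ∀ {a b p₁ e₁ p₂ e₂} → a ≡ b + p₁ * e₁ + p₂ * e₂ → e₁ ≡ 0# → e₂ ≡ 0# → a ≡ b
  ≡-mod₂ a≡ e₁≡0 e₂≡0 = ≡-mod₁ (≡-mod₁ a≡ e₂≡0) e₁≡0

  ≡-mod₃ : ∀ {a b p₁ e₁ p₂ e₂ p₃ e₃} → a ≡ b + p₁ * e₁ + p₂ * e₂ + p₃ * e₃ →
           e₁ ≡ 0# → e₂ ≡ 0# → e₃ ≡ 0# → a ≡ b
  ≡-mod₃ a≡ e₁≡0 e₂≡0 e₃≡0 = ≡-mod₂ (≡-mod₁ a≡ e₃≡0) e₁≡0 e₂≡0

  x≡y⇒x-y≡0 : ∀ {x y} → x ≡ y → x - y ≡ 0#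
  x≡y⇒x-y≡0 {y = y} refl = -‿inverseʳ y

  x-y≡0⇒x≡y : ∀ {x y} → x - y ≡ 0# → x ≡ y
  x-y≡0⇒x≡y {x} {y} = ≡-mod₁ (solve 2 (λ x y → x := y :+ # 1 :* (x :- y)) refl x y)

  -x≡0⇒x≡0 : ∀ {x} → - x ≡ 0# → x ≡ 0#
  -x≡0⇒x≡0 {x} = ≡-mod₁ (solve 1 (λ x → x := # 0 :+ (:- # 1) :* (:- x)) refl x)

  x*y≡0⇒x≡0⊎y≡0 : ∀ {x y} → x * y ≡ 0# → x ≡ 0# ⊎ y ≡ 0#
  x*y≡0⇒x≡0⊎y≡0 {x} {y} xy≡0 with x ≟ 0#
  ... | yes x≡0 = inj₁ x≡0
  ... | no x≢0 with inverse x x≢0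
  ...   | x⁻¹ , xx⁻¹≡1 = inj₂ (≡-mod₂ identity xy≡0 (x≡y⇒x-y≡0 xx⁻¹≡1))
    where
    identity : y ≡ 0# + x⁻¹ * (x * y) + (- y) * (x * x⁻¹ - 1#)
    identity = solve 3 (λ x x⁻¹ y → y := # 0 :+ x⁻¹ :* (x :* y) :+ (:- y) :* (x :* x⁻¹ :- # 1)) refl x x⁻¹ y

  x+y≡0⇒x≡-y : ∀ {x y} → x + y ≡ 0# → x ≡ - y
  x+y≡0⇒x≡-y {x} {y} = ≡-mod₁ (solve 2 (λ x y → x := :- y :+ # 1 :* (x :+ y)) refl x y)

  -‿nonzero : ∀ {x} → x ≢ 0# → - x ≢ 0#
  -‿nonzero x≢0 -x≡0 = x≢0 (-x≡0⇒x≡0 -x≡0)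

  x*y≡1⇒y≢0 : ∀ {x y} → x * y ≡ 1# → y ≢ 0#
  x*y≡1⇒y≢0 {x} xy≡1 refl = 0≢1 (trans (sym (zeroʳ x)) xy≡1)

  *-nonzero : ∀ {x y} → x ≢ 0# → y ≢ 0# → x * y ≢ 0#
  *-nonzero x≢0 y≢0 xy≡0 = [ x≢0 , y≢0 ]′ (x*y≡0⇒x≡0⊎y≡0 xy≡0)

  x≢0∧x*y≡0⇒y≡0 : ∀ {x y} → x ≢ 0# → x * y ≡ 0# → y ≡ 0#
  x≢0∧x*y≡0⇒y≡0 x≢0 xy≡0 = [ (λ x≡0 → contradiction x≡0 x≢0) , id ]′ (x*y≡0⇒x≡0⊎y≡0 xy≡0)

  y≢0∧x*y≡0⇒x≡0 : ∀ {x y} → y ≢ 0# → x * y ≡ 0# → x ≡ 0#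
  y≢0∧x*y≡0⇒x≡0 y≢0 xy≡0 = [ id , (λ y≡0 → contradiction y≡0 y≢0) ]′ (x*y≡0⇒x≡0⊎y≡0 xy≡0)

  x*x≡0⇒x≡0 : ∀ {x} → x * x ≡ 0# → x ≡ 0#
  x*x≡0⇒x≡0 xx≡0 = [ id , id ]′ (x*y≡0⇒x≡0⊎y≡0 xx≡0)

  *-cancelˡ : ∀ {x y z} → x ≢ 0# → x * y ≡ x * z → y ≡ z
  *-cancelˡ {x} {y} {z} x≢0 xy≡xz =
    x-y≡0⇒x≡y (x≢0∧x*y≡0⇒y≡0 x≢0 (≡-mod₁ identity (x≡y⇒x-y≡0 xy≡xz)))
    where
    identity : x * (y - z) ≡ 0# + 1# * (x * y - x * z)
    identity = solve 3 (λ x y z → x :* (y :- z) := # 0 :+ # 1 :* (x :* y :- x :* z)) refl x y z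

  x≡c*x⇒c≡1 : ∀ {x c} → x ≢ 0# → x ≡ c * x → c ≡ 1#
  x≡c*x⇒c≡1 {x} {c} x≢0 x≡cx = *-cancelˡ x≢0 (trans (*-comm x c) (trans (sym x≡cx) (sym (*-identityʳ x))))

  -x*-x≡x*x : ∀ x → - x * - x ≡ x * x
  -x*-x≡x*x = solve 1 (λ x → :- x :* :- x := x :* x) refl

  x*x≡y*y⇒x≡±y : ∀ {x y} → x * x ≡ y * y → x ≡ y ⊎ x ≡ - y
  x*x≡y*y⇒x≡±y {x} {y} xx≡yy =
    Sum.map x-y≡0⇒x≡y x+y≡0⇒x≡-y (x*y≡0⇒x≡0⊎y≡0 (≡-mod₁ identity (x≡y⇒x-y≡0 xx≡yy)))
    where
    identity : (x - y) * (x + y) ≡ 0# + 1# * (x * x - y * y)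
    identity = solve 2 (λ x y → (x :- y) :* (x :+ y) := # 0 :+ # 1 :* (x :* x :- y :* y)) refl x y

module FiniteFieldProperties {q : ℕ} (F : FiniteField q) where

  open FiniteField F
  private module E = Inverse (⤖⇒↔ enumeration)

  from-injective : ∀ {i j} → E.from i ≡ E.from j → i ≡ j
  from-injective {i} {j} eq = trans (sym (E.strictlyInverseˡ i)) (trans (cong E.to eq) (E.strictlyInverseˡ j))

  infix 4 _≟_
  _≟_ : DecidableEquality Carrier
  x ≟ y = map′ to-injective (cong E.to) (E.to x Fin.≟ E.to y)
    where
    to-injective : E.to x ≡ E.to y → x ≡ y
    to-injective eq = trans (sym (E.strictlyInverseʳ x)) (trans (cong E.from eq) (E.strictlyInverseʳ y))

  open DecidableField field′ _≟_ public

  2≢0 : q % 2 ≡ 1 → 2# ≢ 0#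
  2≢0 q-odd 2≡0 = ℕ.0≢1+n (trans (sym q-even) q-odd)
    where
    shift : Fin q → Fin q
    shift i = E.to (E.from i + 1#)

    shift-involutive : ∀ i → shift (shift i) ≡ i
    shift-involutive i = begin
      E.to (E.from (E.to (x + 1#)) + 1#)   ≡⟨ cong (λ y → E.to (y + 1#)) (E.strictlyInverseʳ (x + 1#)) ⟩
      E.to (x + 1# + 1#)                   ≡⟨ cong E.to (≡-mod₁ identity 2≡0) ⟩
      E.to x                               ≡⟨ E.strictlyInverseˡ i ⟩
      i                                    ∎
      where
      open ≡-Reasoning
      x : Carrier
      x = E.from i
      identity : x + 1# + 1# ≡ x + 1# * 2#
      identity = solve 1 (λ x → x :+ # 1 :+ # 1 := x :+ # 1 :* # 2) refl x

    shift-fixedPointFree : ∀ i → shift i ≢ i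
    shift-fixedPointFree i shift-i≡i = 0≢1 (sym (≡-mod₁ identity (x≡y⇒x-y≡0 x+1≡x)))
      where
      x : Carrier
      x = E.from i
      x+1≡x : x + 1# ≡ x
      x+1≡x = trans (sym (E.strictlyInverseʳ (x + 1#))) (cong E.from shift-i≡i)
      identity : 1# ≡ 0# + 1# * (x + 1# - x)
      identity = solve 1 (λ x → # 1 := # 0 :+ # 1 :* (x :+ # 1 :- x)) refl x

    q-even : q % 2 ≡ 0
    q-even = fixedPointFreeInvolution⇒even q shift shift-involutive shift-fixedPointFree

  √-1-candidate : ∃[ c ] (∀ x → x * x ≡ - 1# → c * c ≡ - 1#)
  √-1-candidate with Fin.any? (λ i → E.from i * E.from i ≟ - 1#)
  ... | yes (j , jj≡-1) = E.from j , λ _ _ → jj≡-1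
  ... | no no-root = 0# , λ x xx≡-1 → contradiction (E.to x , subst (λ y → y * y ≡ - 1#) (sym (E.strictlyInverseʳ x)) xx≡-1) no-root

  m≢0∧m²≢±1? : ∀ m → Dec (m ≢ 0# × m * m ≢ 1# × m * m ≢ - 1#)
  m≢0∧m²≢±1? m = ¬? (m ≟ 0#) ×-dec ¬? (m * m ≟ 1#) ×-dec ¬? (m * m ≟ - 1#)

  ¬[m≢0∧m²≢±1]⇒m∈roots : ∀ {c} → (∀ x → x * x ≡ - 1# → c * c ≡ - 1#) →
    ∀ m → ¬ (m ≢ 0# × m * m ≢ 1# × m * m ≢ - 1#) → m ∈ 0# ∷ 1# ∷ - 1# ∷ c ∷ - c ∷ []
  ¬[m≢0∧m²≢±1]⇒m∈roots {c} c-root m bad with m ≟ 0# | m * m ≟ 1# | m * m ≟ - 1#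
  ... | yes m≡0 | _ | _ = here m≡0
  ... | no _ | yes mm≡1 | _ =
    [ there ∘ here , there ∘ there ∘ here ]′ (x*x≡y*y⇒x≡±y (trans mm≡1 (sym (*-identityˡ 1#))))
  ... | no _ | no _ | yes mm≡-1 =
    [ there ∘ there ∘ there ∘ here , there ∘ there ∘ there ∘ there ∘ here ]′
      (x*x≡y*y⇒x≡±y (trans mm≡-1 (sym (c-root m mm≡-1))))
  ... | no m≢0 | no mm≢1 | no mm≢-1 = contradiction (m≢0 , mm≢1 , mm≢-1) bad

  -- The excluded values are 0, ±1 and the square roots of −1: at most five elements.
  ∃-m≢0∧m²≢±1 : 6 ≤ q → ∃[ m ] (m ≢ 0# × m * m ≢ 1# × m * m ≢ - 1#)
  ∃-m≢0∧m²≢±1 6≤q with Fin.any? (λ i → m≢0∧m²≢±1? (E.from i))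
  ... | yes (i , good) = E.from i , good
  ... | no none = contradiction (ℕ.≤-trans 6≤q q≤5) (ℕ.<-irrefl refl)
    where
    q≤5 : q ≤ 5
    q≤5 = injection-into-list⇒≤ _ E.from from-injective
            (λ i → ¬[m≢0∧m²≢±1]⇒m∈roots (proj₂ √-1-candidate) (E.from i) (λ good → none (i , good)))

module ConicGeometry {q : ℕ} (F : FiniteField q) where

  open FiniteField F
  open FiniteFieldProperties F public
  open Geometry F

  ∝-sym : ∀ {P Q} → Proportional P Q → Proportional Q P
  ∝-sym {x , y , z} (c , c≢0 , refl , refl , refl) with inverse c c≢0
  ... | c⁻¹ , cc⁻¹≡1 = c⁻¹ , x*y≡1⇒y≢0 cc⁻¹≡1 , unscale x , unscale y , unscale z
    where
    unscale : ∀ t → t ≡ c⁻¹ * (c * t)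
    unscale t = ≡-mod₁ (solve 3 (λ c c⁻¹ t → t := c⁻¹ :* (c :* t) :+ (:- t) :* (c :* c⁻¹ :- # 1)) refl c c⁻¹ t)
                       (x≡y⇒x-y≡0 cc⁻¹≡1)

  ∝-trans : ∀ {P Q R} → Proportional P Q → Proportional Q R → Proportional P R
  ∝-trans {x , y , z} (c , c≢0 , refl , refl , refl) (d , d≢0 , refl , refl , refl) =
    d * c , *-nonzero d≢0 c≢0 , sym (*-assoc d c x) , sym (*-assoc d c y) , sym (*-assoc d c z)

  ∝-resp-∈L : ∀ {P Q L} → Proportional P Q → P ∈L L → Q ∈L L
  ∝-resp-∈L {x , y , z} {L = u , v , w} (c , _ , refl , refl , refl) P∈L = ≡-mod₁ identity P∈L
    where
    identity : u * (c * x) + v * (c * y) + w * (c * z) ≡ 0# + c * (u * x + v * y + w * z)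
    identity = solve 7 (λ u v w c x y z → u :* (c :* x) :+ v :* (c :* y) :+ w :* (c :* z)
                                       := # 0 :+ c :* (u :* x :+ v :* y :+ w :* z)) refl u v w c x y z

  ∈L-resp-∝ : ∀ {P L M} → Proportional L M → P ∈L M → P ∈L L
  ∈L-resp-∝ {x , y , z} {u , v , w} (c , c≢0 , refl , refl , refl) P∈M =
    x≢0∧x*y≡0⇒y≡0 c≢0 (≡-mod₁ identity P∈M)
    where
    identity : c * (u * x + v * y + w * z) ≡ 0# + 1# * (c * u * x + c * v * y + c * w * z)
    identity = solve 7 (λ u v w c x y z → c :* (u :* x :+ v :* y :+ w :* z)
                                       := # 0 :+ # 1 :* (c :* u :* x :+ c :* v :* y :+ c :* w :* z)) refl u v w c x y z

  tangent-meets-once : ∀ {k L P Q} → Tangent k L →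
    NonZero P → P ∈L L → OnC k P → NonZero Q → Q ∈L L → OnC k Q → Proportional P Q
  tangent-meets-once (_ , _ , _ , _ , _ , meets-only-at) P≢0 P∈L P∈C Q≢0 Q∈L Q∈C =
    ∝-trans (∝-sym (meets-only-at _ P≢0 P∈L P∈C)) (meets-only-at _ Q≢0 Q∈L Q∈C)

  O : Triple
  O = 1# , 0# , 0#

  -- Every point of C_k other than O is a multiple of  conicPoint k s  for a unique s,
  -- and  tangentAt k s  is the tangent line of C_k at that point.
  conicPoint tangentAt : Carrier → Carrier → Triple
  conicPoint k s = s * s , - k , s
  tangentAt  k s = - k , s * s , 2# * k * s

  O-nonzero : NonZero O
  O-nonzero (1≡0 , _) = 0≢1 (sym 1≡0)

  O∈C : ∀ {k} → OnC k O
  O∈C {k} = solve 1 (λ k → # 1 :* # 0 :+ k :* (# 0 :* # 0) := # 0) refl k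

  conicPoint∈C : ∀ {k} s → OnC k (conicPoint k s)
  conicPoint∈C {k} = solve 2 (λ k s → s :* s :* :- k :+ k :* (s :* s) := # 0) refl k

  module _ {k : Carrier} (k≢0 : k ≢ 0#) where

    conicPoint-nonzero : ∀ s → NonZero (conicPoint k s)
    conicPoint-nonzero s (_ , -k≡0 , _) = -‿nonzero k≢0 -k≡0

    O≁conicPoint : ∀ s → ¬ Proportional O (conicPoint k s)
    O≁conicPoint s (c , _ , _ , -k≡c*0 , _) = -‿nonzero k≢0 (trans -k≡c*0 (zeroʳ c))

    conicPoint-injective : ∀ {s t} → Proportional (conicPoint k s) (conicPoint k t) → s ≡ t
    conicPoint-injective {s} (c , _ , _ , -k≡c*-k , t≡c*s) =
      sym (trans t≡c*s (trans (cong (_* s) c≡1) (*-identityˡ s)))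
      where
      c≡1 : c ≡ 1#
      c≡1 = x≡c*x⇒c≡1 (-‿nonzero k≢0) -k≡c*-k

    tangentAt-injective : 2# ≢ 0# → ∀ {s t} → Proportional (tangentAt k s) (tangentAt k t) → s ≡ t
    tangentAt-injective 2≢0 {s} {t} (c , _ , -k≡c*-k , _ , 2kt≡c*2ks) =
      sym (*-cancelˡ (*-nonzero 2≢0 k≢0) (trans 2kt≡c*2ks (trans (cong (_* (2# * k * s)) c≡1) (*-identityˡ _))))
      where
      c≡1 : c ≡ 1#
      c≡1 = x≡c*x⇒c≡1 (-‿nonzero k≢0) -k≡c*-k

    k⁻¹ : Carrier
    k⁻¹ = proj₁ (inverse k k≢0)

    kk⁻¹-1≡0 : k * k⁻¹ - 1# ≡ 0#
    kk⁻¹-1≡0 = x≡y⇒x-y≡0 (proj₂ (inverse k k≢0))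

    tangentAt-tangent : ∀ s → Tangent k (tangentAt k s)
    tangentAt-tangent s =
      (λ (-k≡0 , _) → -‿nonzero k≢0 -k≡0) ,
      conicPoint k s , conicPoint-nonzero s , conicPoint∈tangentAt , conicPoint∈C s , meets-only-at-conicPoint
      where
      conicPoint∈tangentAt : conicPoint k s ∈L tangentAt k s
      conicPoint∈tangentAt = solve 2 (λ k s → :- k :* (s :* s) :+ s :* s :* :- k :+ # 2 :* k :* s :* s := # 0) refl k s

      meets-only-at-conicPoint : ∀ Q → NonZero Q → Q ∈L tangentAt k s → OnC k Q → Proportional (conicPoint k s) Q
      meets-only-at-conicPoint (X , Y , Z) Q≢0 Q∈L Q∈C = c , c≢0 , X≡ , Y≡ , Z≡
        where
        sY+kZ≡0 : s * Y + k * Z ≡ 0#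
        sY+kZ≡0 = x*x≡0⇒x≡0 (≡-mod₂ (solve 5 (λ k s X Y Z →
          (s :* Y :+ k :* Z) :* (s :* Y :+ k :* Z)
            := # 0 :+ k :* (X :* Y :+ k :* (Z :* Z)) :+ Y :* (:- k :* X :+ s :* s :* Y :+ # 2 :* k :* s :* Z))
          refl k s X Y Z) Q∈C Q∈L)
        c : Carrier
        c = - (Y * k⁻¹)
        X≡ : X ≡ c * (s * s)
        X≡ = ≡-mod₃ (solve 6 (λ k k⁻¹ s X Y Z →
          X := :- (Y :* k⁻¹) :* (s :* s) :+ (:- X) :* (k :* k⁻¹ :- # 1)
               :+ (:- k⁻¹) :* (:- k :* X :+ s :* s :* Y :+ # 2 :* k :* s :* Z) :+ (# 2 :* s :* k⁻¹) :* (s :* Y :+ k :* Z))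
          refl k k⁻¹ s X Y Z) kk⁻¹-1≡0 Q∈L sY+kZ≡0
        Y≡ : Y ≡ c * - k
        Y≡ = ≡-mod₁ (solve 3 (λ k k⁻¹ Y → Y := :- (Y :* k⁻¹) :* :- k :+ (:- Y) :* (k :* k⁻¹ :- # 1)) refl k k⁻¹ Y) kk⁻¹-1≡0
        Z≡ : Z ≡ c * s
        Z≡ = ≡-mod₂ (solve 5 (λ k k⁻¹ s Y Z →
          Z := :- (Y :* k⁻¹) :* s :+ k⁻¹ :* (s :* Y :+ k :* Z) :+ (:- Z) :* (k :* k⁻¹ :- # 1))
          refl k k⁻¹ s Y Z) sY+kZ≡0 kk⁻¹-1≡0
        c≢0 : c ≢ 0#
        c≢0 c≡0 = Q≢0 (vanish X≡ , vanish Y≡ , vanish Z≡)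
          where
          vanish : ∀ {t r} → t ≡ c * r → t ≡ 0#
          vanish {r = r} t≡cr = trans t≡cr (trans (cong (_* r) c≡0) (zeroˡ r))

    tangent∋O⇒w≡0 : ∀ {u v w} → Tangent k (u , v , w) → u ≡ 0# → w ≡ 0#
    tangent∋O⇒w≡0 {u} {v} {w} L-tangent u≡0 with w ≟ 0#
    ... | yes w≡0 = w≡0
    ... | no w≢0 = contradiction O∝conicPoint (O≁conicPoint t)
      where
      w⁻¹ t : Carrier
      w⁻¹ = proj₁ (inverse w w≢0)
      t = k * v * w⁻¹
      O∈L : O ∈L (u , v , w)
      O∈L = trans (solve 3 (λ u v w → u :* # 1 :+ v :* # 0 :+ w :* # 0 := u) refl u v w) u≡0
      t∈L : conicPoint k t ∈L (u , v , w)
      t∈L = ≡-mod₂ (solve 5 (λ u v w k w⁻¹ →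
        u :* (k :* v :* w⁻¹ :* (k :* v :* w⁻¹)) :+ v :* :- k :+ w :* (k :* v :* w⁻¹)
          := # 0 :+ (k :* v :* w⁻¹ :* (k :* v :* w⁻¹)) :* u :+ (k :* v) :* (w :* w⁻¹ :- # 1))
        refl u v w k w⁻¹) u≡0 (x≡y⇒x-y≡0 (proj₂ (inverse w w≢0)))
      O∝conicPoint : Proportional O (conicPoint k t)
      O∝conicPoint = tangent-meets-once L-tangent O-nonzero O∈L O∈C (conicPoint-nonzero t) t∈L (conicPoint∈C t)

    conic-parametrization : ∀ {X Y Z} → OnC k (X , Y , Z) → Y ≢ 0# →
      ∃[ s ] Proportional (X , Y , Z) (conicPoint k s)
    conic-parametrization {X} {Y} {Z} P∈C Y≢0 = c * Z , c , c≢0 , s*s≡cX , -k≡cY , refl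
      where
      Y⁻¹ c : Carrier
      Y⁻¹ = proj₁ (inverse Y Y≢0)
      c = - k * Y⁻¹
      YY⁻¹-1≡0 : Y * Y⁻¹ - 1# ≡ 0#
      YY⁻¹-1≡0 = x≡y⇒x-y≡0 (proj₂ (inverse Y Y≢0))
      c≢0 : c ≢ 0#
      c≢0 = *-nonzero (-‿nonzero k≢0) (x*y≡1⇒y≢0 (proj₂ (inverse Y Y≢0)))
      s*s≡cX : c * Z * (c * Z) ≡ c * X
      s*s≡cX = ≡-mod₂ (solve 5 (λ k Y⁻¹ X Y Z →
        :- k :* Y⁻¹ :* Z :* (:- k :* Y⁻¹ :* Z)
          := :- k :* Y⁻¹ :* X :+ (k :* Y⁻¹ :* Y⁻¹) :* (X :* Y :+ k :* (Z :* Z)) :+ (:- (k :* Y⁻¹ :* X)) :* (Y :* Y⁻¹ :- # 1))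
        refl k Y⁻¹ X Y Z) P∈C YY⁻¹-1≡0
      -k≡cY : - k ≡ c * Y
      -k≡cY = ≡-mod₁ (solve 3 (λ k Y⁻¹ Y → :- k := :- k :* Y⁻¹ :* Y :+ k :* (Y :* Y⁻¹ :- # 1)) refl k Y⁻¹ Y) YY⁻¹-1≡0

    -- Vieta: the two points of C_k on the line are  conicPoint k s  for the roots s of
    -- u s² + w s − k v = 0, whose sum is −w/u.
    second-intersection : ∀ {u v w u⁻¹ s} → u * u⁻¹ ≡ 1# → conicPoint k s ∈L (u , v , w) →
      conicPoint k (- (w * u⁻¹) - s) ∈L (u , v , w)
    second-intersection {u} {v} {w} {u⁻¹} {s} uu⁻¹≡1 s∈L = ≡-mod₂ (solve 6 (λ u v w k u⁻¹ s →
      u :* ((:- (w :* u⁻¹) :- s) :* (:- (w :* u⁻¹) :- s)) :+ v :* :- k :+ w :* (:- (w :* u⁻¹) :- s)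
        := # 0 :+ # 1 :* (u :* (s :* s) :+ v :* :- k :+ w :* s) :+ ((:- (w :* u⁻¹) :- s :- s) :* (:- w)) :* (u :* u⁻¹ :- # 1))
      refl u v w k u⁻¹ s) s∈L (x≡y⇒x-y≡0 uu⁻¹≡1)

    double-root⇒tangentAt : ∀ {u v w s} → u ≢ 0# → conicPoint k s ∈L (u , v , w) → w + 2# * u * s ≡ 0# →
      Proportional (tangentAt k s) (u , v , w)
    double-root⇒tangentAt {u} {v} {w} {s} u≢0 s∈L w+2us≡0 = c , c≢0 , u≡ , v≡ , w≡
      where
      c : Carrier
      c = - (u * k⁻¹)
      u≡ : u ≡ c * - k
      u≡ = ≡-mod₁ (solve 3 (λ u k k⁻¹ → u := :- (u :* k⁻¹) :* :- k :+ (:- u) :* (k :* k⁻¹ :- # 1)) refl u k k⁻¹) kk⁻¹-1≡0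
      v≡ : v ≡ c * (s * s)
      v≡ = ≡-mod₃ (solve 6 (λ u v w k k⁻¹ s →
        v := :- (u :* k⁻¹) :* (s :* s) :+ (:- k⁻¹) :* (u :* (s :* s) :+ v :* :- k :+ w :* s)
             :+ (k⁻¹ :* s) :* (w :+ # 2 :* u :* s) :+ (:- v) :* (k :* k⁻¹ :- # 1))
        refl u v w k k⁻¹ s) s∈L w+2us≡0 kk⁻¹-1≡0
      w≡ : w ≡ c * (2# * k * s)
      w≡ = ≡-mod₂ (solve 5 (λ u w k k⁻¹ s →
        w := :- (u :* k⁻¹) :* (# 2 :* k :* s) :+ # 1 :* (w :+ # 2 :* u :* s) :+ (# 2 :* u :* s) :* (k :* k⁻¹ :- # 1))
        refl u w k k⁻¹ s) w+2us≡0 kk⁻¹-1≡0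
      c≢0 : c ≢ 0#
      c≢0 c≡0 = u≢0 (trans u≡ (trans (cong (_* - k) c≡0) (zeroˡ (- k))))

    tangent-classification : ∀ {u v w} → Tangent k (u , v , w) → u ≢ 0# →
      ∃[ s ] Proportional (tangentAt k s) (u , v , w)
    tangent-classification {u} {v} {w} L-tangent@(_ , (X , Y , Z) , T≢0 , T∈L , T∈C , _) u≢0 =
      s , double-root⇒tangentAt u≢0 s∈L w+2us≡0
      where
      Y≢0 : Y ≢ 0#
      Y≢0 Y≡0 = T≢0 (X≡0 , Y≡0 , Z≡0)
        where
        Z≡0 : Z ≡ 0#
        Z≡0 = x*x≡0⇒x≡0 (x≢0∧x*y≡0⇒y≡0 k≢0
          (≡-mod₂ (solve 4 (λ k X Y Z → k :* (Z :* Z) := # 0 :+ # 1 :* (X :* Y :+ k :* (Z :* Z)) :+ (:- X) :* Y)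
            refl k X Y Z) T∈C Y≡0))
        X≡0 : X ≡ 0#
        X≡0 = x≢0∧x*y≡0⇒y≡0 u≢0
          (≡-mod₃ (solve 6 (λ u v w X Y Z →
            u :* X := # 0 :+ # 1 :* (u :* X :+ v :* Y :+ w :* Z) :+ (:- v) :* Y :+ (:- w) :* Z)
            refl u v w X Y Z) T∈L Y≡0 Z≡0)
      s t u⁻¹ : Carrier
      s = proj₁ (conic-parametrization T∈C Y≢0)
      u⁻¹ = proj₁ (inverse u u≢0)
      t = - (w * u⁻¹) - s
      s∈L : conicPoint k s ∈L (u , v , w)
      s∈L = ∝-resp-∈L (proj₂ (conic-parametrization T∈C Y≢0)) T∈L
      t∈L : conicPoint k t ∈L (u , v , w)
      t∈L = second-intersection (proj₂ (inverse u u≢0)) s∈L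
      s≡t : s ≡ t
      s≡t = conicPoint-injective
        (tangent-meets-once L-tangent (conicPoint-nonzero s) s∈L (conicPoint∈C s) (conicPoint-nonzero t) t∈L (conicPoint∈C t))
      w+2us≡0 : w + 2# * u * s ≡ 0#
      w+2us≡0 = ≡-mod₂ (solve 4 (λ u w u⁻¹ s →
        w :+ # 2 :* u :* s := # 0 :+ (:- u) :* (:- (w :* u⁻¹) :- s :- s) :+ (:- w) :* (u :* u⁻¹ :- # 1))
        refl u w u⁻¹ s) (x≡y⇒x-y≡0 (sym s≡t)) (x≡y⇒x-y≡0 (proj₂ (inverse u u≢0)))

    -- (x, y, z) with y ≠ 0 lies on  tangentAt k s  iff  (y s + k z)² = k (x y + k z²),
    -- so the tangents through it touch at the parameters  (− k z ± δ) / y  with  δ² = k (x y + k z²).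
    tangentParameter : Carrier → Carrier → Carrier → Carrier
    tangentParameter z y⁻¹ δ = (- (k * z) + δ) * y⁻¹

    ∈tangentAt-parameter : ∀ {x y z y⁻¹ ε} → y * y⁻¹ ≡ 1# → ε * ε ≡ k * (x * y + k * (z * z)) →
      (x , y , z) ∈L tangentAt k (tangentParameter z y⁻¹ ε)
    ∈tangentAt-parameter {x} {y} {z} {y⁻¹} {ε} yy⁻¹≡1 ε² = ≡-mod₂ (solve 6 (λ k x y z y⁻¹ ε →
      :- k :* x :+ (:- (k :* z) :+ ε) :* y⁻¹ :* ((:- (k :* z) :+ ε) :* y⁻¹) :* y :+ # 2 :* k :* ((:- (k :* z) :+ ε) :* y⁻¹) :* z
        := # 0 :+ (k :* x :+ (:- (k :* z) :+ ε) :* (:- (k :* z) :+ ε) :* y⁻¹) :* (y :* y⁻¹ :- # 1)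
               :+ y⁻¹ :* (ε :* ε :- k :* (x :* y :+ k :* (z :* z))))
      refl k x y z y⁻¹ ε) (x≡y⇒x-y≡0 yy⁻¹≡1) (x≡y⇒x-y≡0 ε²)

    ∈tangentAt⇒parameter : ∀ {x y z y⁻¹ δ s} → y * y⁻¹ ≡ 1# → δ * δ ≡ k * (x * y + k * (z * z)) →
      (x , y , z) ∈L tangentAt k s → s ≡ tangentParameter z y⁻¹ δ ⊎ s ≡ tangentParameter z y⁻¹ (- δ)
    ∈tangentAt⇒parameter {x} {y} {z} {y⁻¹} {δ} {s} yy⁻¹≡1 δ² P∈L =
      Sum.map parameter-of parameter-of (x*x≡y*y⇒x≡±y [ys+kz]²≡δ²)
      where
      [ys+kz]²≡δ² : (y * s + k * z) * (y * s + k * z) ≡ δ * δ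
      [ys+kz]²≡δ² = ≡-mod₂ (solve 6 (λ k x y z δ s →
        (y :* s :+ k :* z) :* (y :* s :+ k :* z)
          := δ :* δ :+ y :* (:- k :* x :+ s :* s :* y :+ # 2 :* k :* s :* z) :+ (:- # 1) :* (δ :* δ :- k :* (x :* y :+ k :* (z :* z))))
        refl k x y z δ s) P∈L (x≡y⇒x-y≡0 δ²)
      parameter-of : ∀ {ε} → y * s + k * z ≡ ε → s ≡ tangentParameter z y⁻¹ ε
      parameter-of {ε} ys+kz≡ε = ≡-mod₂ (solve 6 (λ k y z y⁻¹ ε s →
        s := (:- (k :* z) :+ ε) :* y⁻¹ :+ y⁻¹ :* (y :* s :+ k :* z :- ε) :+ (:- s) :* (y :* y⁻¹ :- # 1))
        refl k y z y⁻¹ ε s) (x≡y⇒x-y≡0 ys+kz≡ε) (x≡y⇒x-y≡0 yy⁻¹≡1)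

    tangent-through-point : ∀ {x y z y⁻¹ δ} → y ≢ 0# → y * y⁻¹ ≡ 1# → δ * δ ≡ k * (x * y + k * (z * z)) →
      ∀ L → Tangent k L → (x , y , z) ∈L L →
      Proportional (tangentAt k (tangentParameter z y⁻¹ δ)) L ⊎ Proportional (tangentAt k (tangentParameter z y⁻¹ (- δ))) L
    tangent-through-point {x} {y} {z} {y⁻¹} {δ} y≢0 yy⁻¹≡1 δ² (u , v , w) L-tangent P∈L with u ≟ 0#
    ... | yes u≡0 = contradiction (u≡0 , v≡0 , w≡0) (proj₁ L-tangent)
      where
      w≡0 : w ≡ 0#
      w≡0 = tangent∋O⇒w≡0 L-tangent u≡0
      v≡0 : v ≡ 0#
      v≡0 = y≢0∧x*y≡0⇒x≡0 y≢0 (≡-mod₃ (solve 6 (λ u v w x y z →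
        v :* y := # 0 :+ # 1 :* (u :* x :+ v :* y :+ w :* z) :+ (:- x) :* u :+ (:- z) :* w)
        refl u v w x y z) P∈L u≡0 w≡0)
    ... | no u≢0 = through-tangentAt (tangent-classification L-tangent u≢0)
      where
      at : ∀ {s r} → Proportional (tangentAt k s) (u , v , w) → s ≡ r → Proportional (tangentAt k r) (u , v , w)
      at s∝L refl = s∝L
      through-tangentAt : ∃[ s ] Proportional (tangentAt k s) (u , v , w) →
        Proportional (tangentAt k (tangentParameter z y⁻¹ δ)) (u , v , w) ⊎
        Proportional (tangentAt k (tangentParameter z y⁻¹ (- δ))) (u , v , w)
      through-tangentAt (s , s∝L) = Sum.map (at s∝L) (at s∝L) (∈tangentAt⇒parameter yy⁻¹≡1 δ² (∈L-resp-∝ s∝L P∈L))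

    exterior-criterion : 2# ≢ 0# → ∀ {x y z δ} → y ≢ 0# → δ ≢ 0# → δ * δ ≡ k * (x * y + k * (z * z)) →
      Exterior k (x , y , z)
    exterior-criterion 2≢0 {x} {y} {z} {δ} y≢0 δ≢0 δ² =
      (λ (_ , y≡0 , _) → y≢0 y≡0) , P∉C ,
      tangentAt k (tangentParameter z y⁻¹ δ) , tangentAt k (tangentParameter z y⁻¹ (- δ)) ,
      tangentAt-tangent _ , tangentAt-tangent _ ,
      ∈tangentAt-parameter yy⁻¹≡1 δ² , ∈tangentAt-parameter yy⁻¹≡1 (trans (-x*-x≡x*x δ) δ²) ,
      parameters-distinct ∘ tangentAt-injective 2≢0 , tangent-through-point y≢0 yy⁻¹≡1 δ²
      where
      y⁻¹ : Carrier
      y⁻¹ = proj₁ (inverse y y≢0)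
      yy⁻¹≡1 : y * y⁻¹ ≡ 1#
      yy⁻¹≡1 = proj₂ (inverse y y≢0)
      P∉C : ¬ OnC k (x , y , z)
      P∉C P∈C = δ≢0 (x*x≡0⇒x≡0 (trans δ² (trans (cong (k *_) P∈C) (zeroʳ k))))
      parameters-distinct : tangentParameter z y⁻¹ δ ≢ tangentParameter z y⁻¹ (- δ)
      parameters-distinct eq = *-nonzero 2≢0 δ≢0 (≡-mod₂ (solve 5 (λ k z y y⁻¹ δ →
        # 2 :* δ := # 0 :+ y :* ((:- (k :* z) :+ δ) :* y⁻¹ :- (:- (k :* z) :+ :- δ) :* y⁻¹) :+ (:- (# 2 :* δ)) :* (y :* y⁻¹ :- # 1))
        refl k z y y⁻¹ δ) (x≡y⇒x-y≡0 eq) (x≡y⇒x-y≡0 yy⁻¹≡1))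

  onC⇒exterior : 2# ≢ 0# → ∀ {a b β} → a ≢ 0# → b ≢ 0# → β ≢ 0# → β * β ≡ b * (b - a) →
    ∀ P → NonZero P → OnC a P → ¬ OnC b P → Exterior b P
  onC⇒exterior 2≢0 {a} {b} {β} a≢0 b≢0 β≢0 β² (x , y , z) _ P∈C-a P∉C-b =
    exterior-criterion b≢0 2≢0 y≢0 (*-nonzero β≢0 z≢0) δ²
    where
    z≢0 : z ≢ 0#
    z≢0 z≡0 = P∉C-b (≡-mod₂ (solve 5 (λ a b x y z →
      x :* y :+ b :* (z :* z) := # 0 :+ # 1 :* (x :* y :+ a :* (z :* z)) :+ ((b :- a) :* z) :* z)
      refl a b x y z) P∈C-a z≡0)
    y≢0 : y ≢ 0#
    y≢0 y≡0 = z≢0 (x*x≡0⇒x≡0 (x≢0∧x*y≡0⇒y≡0 a≢0 (≡-mod₂ (solve 4 (λ a x y z →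
      a :* (z :* z) := # 0 :+ # 1 :* (x :* y :+ a :* (z :* z)) :+ (:- x) :* y)
      refl a x y z) P∈C-a y≡0)))
    δ² : β * z * (β * z) ≡ b * (x * y + b * (z * z))
    δ² = ≡-mod₂ (solve 6 (λ a b β x y z →
      β :* z :* (β :* z) := b :* (x :* y :+ b :* (z :* z)) :+ (:- b) :* (x :* y :+ a :* (z :* z)) :+ (z :* z) :* (β :* β :- b :* (b :- a)))
      refl a b β x y z) P∈C-a (x≡y⇒x-y≡0 β²)

  mutuallyExterior : 2# ≢ 0# → ∀ {a b α β} → a ≢ 0# → b ≢ 0# → α ≢ 0# → β ≢ 0# →
    α * α ≡ a * (a - b) → β * β ≡ b * (b - a) → MutuallyExterior a b
  mutuallyExterior 2≢0 a≢0 b≢0 α≢0 β≢0 α² β² =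
    onC⇒exterior 2≢0 a≢0 b≢0 β≢0 β² , onC⇒exterior 2≢0 b≢0 a≢0 α≢0 α²

  -- (2m)² + (m² − 1)² = (m² + 1)² is what makes a (a − b) and b (b − a) squares.
  pythagoreanConics : 2# ≢ 0# → ∀ {m} → m ≢ 0# → m * m ≢ 1# → m * m ≢ - 1# →
    let a = 2# * m * (2# * m)
        b = - ((m * m - 1#) * (m * m - 1#))
    in a ≢ 0# × b ≢ 0# × a ≢ b × MutuallyExterior a b
  pythagoreanConics 2≢0 {m} m≢0 m²≢1 m²≢-1 =
    a≢0 , b≢0 , a≢b , mutuallyExterior 2≢0 a≢0 b≢0 (*-nonzero 2m≢0 m²+1≢0) (*-nonzero m²-1≢0 m²+1≢0) α² β²
    where
    a b α β : Carrier
    a = 2# * m * (2# * m)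
    b = - ((m * m - 1#) * (m * m - 1#))
    α = 2# * m * (m * m + 1#)
    β = (m * m - 1#) * (m * m + 1#)
    2m≢0 : 2# * m ≢ 0#
    2m≢0 = *-nonzero 2≢0 m≢0
    m²-1≢0 : m * m - 1# ≢ 0#
    m²-1≢0 = m²≢1 ∘ x-y≡0⇒x≡y
    m²+1≢0 : m * m + 1# ≢ 0#
    m²+1≢0 = m²≢-1 ∘ x+y≡0⇒x≡-y
    a≢0 : a ≢ 0#
    a≢0 = *-nonzero 2m≢0 2m≢0
    b≢0 : b ≢ 0#
    b≢0 = -‿nonzero (*-nonzero m²-1≢0 m²-1≢0)
    a≢b : a ≢ b
    a≢b a≡b = *-nonzero m²+1≢0 m²+1≢0 (≡-mod₁ (solve 1 (λ m →
      (m :* m :+ # 1) :* (m :* m :+ # 1)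
        := # 0 :+ # 1 :* (# 2 :* m :* (# 2 :* m) :- :- ((m :* m :- # 1) :* (m :* m :- # 1))))
      refl m) (x≡y⇒x-y≡0 a≡b))
    α² : α * α ≡ a * (a - b)
    α² = solve 1 (λ m → # 2 :* m :* (m :* m :+ # 1) :* (# 2 :* m :* (m :* m :+ # 1))
      := # 2 :* m :* (# 2 :* m) :* (# 2 :* m :* (# 2 :* m) :- :- ((m :* m :- # 1) :* (m :* m :- # 1)))) refl m
    β² : β * β ≡ b * (b - a)
    β² = solve 1 (λ m → (m :* m :- # 1) :* (m :* m :+ # 1) :* ((m :* m :- # 1) :* (m :* m :+ # 1))
      := :- ((m :* m :- # 1) :* (m :* m :- # 1)) :* (:- ((m :* m :- # 1) :* (m :* m :- # 1)) :- # 2 :* m :* (# 2 :* m))) refl m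

mainTheorem4 : (q : ℕ) → IsPrimePower q → q % 2 ≡ 1 → q ≥ 7 →
    (F : FiniteField q) →
    let open FiniteField F
        open Geometry F
    in ∃[ a ] ∃[ b ] (¬ (a ≡ 0#) × ¬ (b ≡ 0#) × ¬ (a ≡ b) × MutuallyExterior a b)
mainTheorem4 q _ q-odd q≥7 F = conics (∃-m≢0∧m²≢±1 (ℕ.≤-trans (ℕ.n≤1+n 6) q≥7))
  where
  open FiniteField F
  open Geometry F
  open ConicGeometry F
  conics : ∃[ m ] (m ≢ 0# × m * m ≢ 1# × m * m ≢ - 1#) →
    ∃[ a ] ∃[ b ] (a ≢ 0# × b ≢ 0# × a ≢ b × MutuallyExterior a b)
  conics (m , m≢0 , m²≢1 , m²≢-1) = _ , _ , pythagoreanConics (2≢0 q-odd) m≢0 m²≢1 m²≢-1
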